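{- Let $k\ge 1$ be an integer. The generating function $\sum_{n\ge 0}P_{\textsc{EnCis}(k),P_n}(x,y)\,t^n$ of the polynomial profiles of $\textsc{EnCis}(k)$ played on paths equals \[\frac{1-t+xt+yt-xt^{k+1}-yt^{k+1}}{(1-t)(1-t-xt^{k+1}-yt^{k+1})}.\] In particular, the generating function $\sum_{n\ge0}P_{\textsc{EnCis}(k),P_n}(1,1)\,t^n$ of the total number of positions equals \[\frac{1+t-2t^{k+1}}{(1-t)(1-t-2t^{k+1})}.\]
   Context: A distance game given by a pair of sets $(S,D)$ of positive integers is played on a finite graph by two players, Left (colouring vertices blue) and Right (colouring vertices red). A position is any assignment to a subset of the vertices of the colours blue or red (other vertices empty) such that no two vertices of the same colour are at graph distance in $S$ and no two vertices of different colours are at graph distance in $D$; no assumption of alternating play is made. $\textsc{EnCis}(k)$ is the distance game with $S=D=\{1,\dots,k\}$. The polynomial profile of a game $G$ on a board $B$ is $P_{G,B}(x,y)=\sum f_{j,l}x^jy^l$, where $f_{j,l}$ is the number of positions with exactly $j$ blue and $l$ red vertices. $P_n$ denotes the path with $n$ vertices; $P_0$ is the empty board, with profile $1$. -}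

module Defs where

open import Data.Bool using (Bool; true; false; _∧_; not; if_then_else_)
open import Data.Nat using (ℕ; zero; suc; _∸_; _≡ᵇ_; _<ᵇ_; _≤ᵇ_; ∣_-_∣)
open import Data.Integer using (ℤ; +_) renaming (_+_ to _+ℤ_; _*_ to _*ℤ_; _-_ to _-ℤ_)
open import Data.Fin using (Fin; toℕ)
open import Data.Maybe using (Maybe; just; nothing)
open import Data.Vec using (Vec; []; _∷_; lookup)
open import Data.List using (List; [_]; concatMap; map; filterᵇ; length) renaming ([] to L[]; _∷_ to _L∷_)
open import Data.Bool.ListAction using (and)
open import Data.List using () renaming (allFin to allFinL)
open import Relation.Nullary.Decidable using (Dec; yes; no)
open import Relation.Binary.PropositionalEquality using (_≡_)

record DistanceGame : Set where
  field
    S : ℕ → Bool   -- forbidden distances between same-coloured vertices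
    D : ℕ → Bool   -- forbidden distances between differently coloured vertices
open DistanceGame public

inOneTo : ℕ → ℕ → Bool
inOneTo k d = (1 ≤ᵇ d) ∧ (d ≤ᵇ k)

EnCis : ℕ → DistanceGame
EnCis k = record { S = inOneTo k ; D = inOneTo k }

-- Colourings of the path P_n (vertices Fin n, distance ∣ i - j ∣)

data Colour : Set where
  blue red : Colour

sameColour : Colour → Colour → Bool
sameColour blue blue = true
sameColour red  red  = true
sameColour _    _    = false

allColourings : (n : ℕ) → List (Vec (Maybe Colour) n)
allColourings zero    = [ [] ]
allColourings (suc n) =
  concatMap (λ v → map (λ c → c ∷ v) (nothing L∷ just blue L∷ just red L∷ L[]))
            (allColourings n)

compatible : DistanceGame → ℕ → Maybe Colour → Maybe Colour → Bool
compatible G d (just a) (just b) = if sameColour a b then not (S G d) else not (D G d)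
compatible G d _        _        = true

_⇒ᵇ_ : Bool → Bool → Bool
false ⇒ᵇ _ = true
true  ⇒ᵇ b = b

allᵇ : {A : Set} → (A → Bool) → List A → Bool
allᵇ p xs = and (map p xs)

isPosition : DistanceGame → (n : ℕ) → Vec (Maybe Colour) n → Bool
isPosition G n c =
  allᵇ (λ i → allᵇ (λ j → (toℕ i <ᵇ toℕ j) ⇒ᵇ
                        compatible G ∣ toℕ i - toℕ j ∣ (lookup c i) (lookup c j))
                 (allFinL n))
      (allFinL n)

isColour : Colour → Maybe Colour → Bool
isColour a (just b) = sameColour a b
isColour a nothing  = false

countColour : Colour → {n : ℕ} → Vec (Maybe Colour) n → ℕ
countColour a []      = 0
countColour a (c ∷ v) = if isColour a c then suc (countColour a v) else countColour a v

profileCoeff : DistanceGame → (n j l : ℕ) → ℕ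
profileCoeff G n j l =
  length (filterᵇ (λ c → isPosition G n c ∧ (countColour blue c ≡ᵇ j)
                                          ∧ (countColour red c ≡ᵇ l))
                 (allColourings n))

-- P_{G,P_n}(1,1) = Σ_{j,l} f_{j,l}  (both degrees are ≤ n)
sumTo : ℕ → (ℕ → ℤ) → ℤ
sumTo zero    f = f 0
sumTo (suc n) f = sumTo n f +ℤ f (suc n)

profileAt11 : DistanceGame → ℕ → ℤ
profileAt11 G n = sumTo n (λ j → sumTo n (λ l → + profileCoeff G n j l))

-- Formal power series in t with coefficients in ℤ[x,y]:
-- A n j l = coefficient of t^n x^j y^l.

Series3 : Set
Series3 = ℕ → ℕ → ℕ → ℤ

_⊕_ : Series3 → Series3 → Series3
(A ⊕ B) n j l = A n j l +ℤ B n j l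

_⊖_ : Series3 → Series3 → Series3
(A ⊖ B) n j l = A n j l -ℤ B n j l

_⊛_ : Series3 → Series3 → Series3
(A ⊛ B) n j l =
  sumTo n λ a → sumTo j λ b → sumTo l λ c → A a b c *ℤ B (n ∸ a) (j ∸ b) (l ∸ c)

infixl 6 _⊕_ _⊖_
infixl 7 _⊛_

mono : ℕ → ℕ → ℕ → Series3
mono a b c n j l = if (a ≡ᵇ n) ∧ (b ≡ᵇ j) ∧ (c ≡ᵇ l) then + 1 else + 0

one Tₛ X Y : Series3
one = mono 0 0 0
Tₛ  = mono 1 0 0
X   = mono 0 1 0
Y   = mono 0 0 1

profileGF : DistanceGame → Series3
profileGF G n j l = + profileCoeff G n j l

numerator : ℕ → Series3
numerator k = one ⊖ Tₛ ⊕ X ⊛ Tₛ ⊕ Y ⊛ Tₛ ⊖ X ⊛ mono (suc k) 0 0 ⊖ Y ⊛ mono (suc k) 0 0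

denominator : ℕ → Series3
denominator k = (one ⊖ Tₛ) ⊛ (one ⊖ Tₛ ⊖ X ⊛ mono (suc k) 0 0 ⊖ Y ⊛ mono (suc k) 0 0)

Series1 : Set
Series1 = ℕ → ℤ

_⊕₁_ _⊖₁_ _⊛₁_ : Series1 → Series1 → Series1
(A ⊕₁ B) n = A n +ℤ B n
(A ⊖₁ B) n = A n -ℤ B n
(A ⊛₁ B) n = sumTo n λ a → A a *ℤ B (n ∸ a)
infixl 6 _⊕₁_ _⊖₁_
infixl 7 _⊛₁_

monoT : ℤ → ℕ → Series1
monoT c a n = if a ≡ᵇ n then c else + 0

totalGF : DistanceGame → Series1
totalGF G n = profileAt11 G n

numerator₁ : ℕ → Series1
numerator₁ k = monoT (+ 1) 0 ⊕₁ monoT (+ 1) 1 ⊖₁ monoT (+ 2) (suc k)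

denominator₁ : ℕ → Series1
denominator₁ k = (monoT (+ 1) 0 ⊖₁ monoT (+ 1) 1)
               ⊛₁ (monoT (+ 1) 0 ⊖₁ monoT (+ 1) 1 ⊖₁ monoT (+ 2) (suc k))

-- A position of EnCis k on P_(n+1) either leaves the first vertex empty, or colours it; a
-- coloured first vertex forces the next k vertices to be empty and constrains nothing else.
-- So if F is the profile series and G_g the series of positions whose first g vertices are
-- empty, then G_(g+1) = 1 + t G_g, whence G_k = (1 + t + ⋯ + t^(k-1)) + t^k F, and
-- (1 - t) F = 1 + t (x + y) G_k. Eliminating G_k and multiplying once more by 1 - t gives the
-- identity. The total number of positions satisfies the same recurrences with x = y = 1.
module Submission where

open import Defs
open import Data.Bool using (Bool; true; false; _∧_; _∨_; not; if_then_else_)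
open import Data.Bool.Properties using (∨-zeroʳ; ∧-zeroʳ)
open import Data.Bool.ListAction using (and)
open import Data.Fin using (Fin; toℕ; zero; suc)
open import Data.Integer using (ℤ; +_) renaming (_+_ to _+ℤ_; _*_ to _*ℤ_; _-_ to _-ℤ_)
open import Data.Integer.Properties
  using (+-identityˡ; +-identityʳ; +-inverseʳ; +-assoc; *-zeroˡ; *-identityˡ; *-identityʳ;
         *-distribˡ-+; *-distribʳ-+)
open import Data.Integer.Tactic.RingSolver using (solve-∀)
open import Data.List using (List; tabulate; filterᵇ; length; concatMap; foldr; _++_)
  renaming ([] to []ᴸ; _∷_ to _∷ᴸ_; allFin to allFinᴸ)
open import Data.List.Properties using (tabulate-cong; map-tabulate)
open import Data.Maybe using (Maybe; just; nothing; is-nothing)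
open import Data.Nat using (ℕ; zero; suc; _∸_; _≡ᵇ_; _<ᵇ_; _≤_; ∣_-_∣)
open import Data.Product using (_×_; _,_)
open import Data.Vec using (Vec; []; _∷_; lookup)
open import Level using (0ℓ)
open import Relation.Binary.Bundles using (Setoid)
open import Relation.Binary.PropositionalEquality
  using (_≡_; refl; sym; trans; cong; cong₂; _≗_; _→-setoid_; module ≡-Reasoning)

Colouring : ℕ → Set
Colouring n = Vec (Maybe Colour) n

*-distribʳ-minus : ∀ a b c → (a -ℤ b) *ℤ c ≡ a *ℤ c -ℤ b *ℤ c
*-distribʳ-minus = solve-∀

sumTo-cong : ∀ n {f g : ℕ → ℤ} → (∀ i → f i ≡ g i) → sumTo n f ≡ sumTo n g
sumTo-cong zero    f≡g = f≡g 0
sumTo-cong (suc n) f≡g = cong₂ _+ℤ_ (sumTo-cong n f≡g) (f≡g (suc n))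

sumTo-zero : ∀ n {f : ℕ → ℤ} → (∀ i → f i ≡ + 0) → sumTo n f ≡ + 0
sumTo-zero zero    f≡0 = f≡0 0
sumTo-zero (suc n) f≡0 = cong₂ _+ℤ_ (sumTo-zero n f≡0) (f≡0 (suc n))

sumTo-+ : ∀ n (f g : ℕ → ℤ) → sumTo n (λ i → f i +ℤ g i) ≡ sumTo n f +ℤ sumTo n g
sumTo-+ zero    f g = refl
sumTo-+ (suc n) f g =
  trans (cong (_+ℤ (f (suc n) +ℤ g (suc n))) (sumTo-+ n f g))
        (interchange (sumTo n f) (sumTo n g) (f (suc n)) (g (suc n)))
  where
  interchange : ∀ a b c d → a +ℤ b +ℤ (c +ℤ d) ≡ a +ℤ c +ℤ (b +ℤ d)
  interchange = solve-∀

sumTo-minus : ∀ n (f g : ℕ → ℤ) → sumTo n (λ i → f i -ℤ g i) ≡ sumTo n f -ℤ sumTo n g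
sumTo-minus zero    f g = refl
sumTo-minus (suc n) f g =
  trans (cong (_+ℤ (f (suc n) -ℤ g (suc n))) (sumTo-minus n f g))
        (interchange (sumTo n f) (sumTo n g) (f (suc n)) (g (suc n)))
  where
  interchange : ∀ a b c d → a -ℤ b +ℤ (c -ℤ d) ≡ a +ℤ c -ℤ (b +ℤ d)
  interchange = solve-∀

sumTo-*ˡ : ∀ n c (f : ℕ → ℤ) → sumTo n (λ i → c *ℤ f i) ≡ c *ℤ sumTo n f
sumTo-*ˡ zero    c f = refl
sumTo-*ˡ (suc n) c f =
  trans (cong (_+ℤ c *ℤ f (suc n)) (sumTo-*ˡ n c f))
        (sym (*-distribˡ-+ c (sumTo n f) (f (suc n))))

sumTo-suc : ∀ n (f : ℕ → ℤ) → sumTo (suc n) f ≡ f 0 +ℤ sumTo n (λ i → f (suc i))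
sumTo-suc zero    f = refl
sumTo-suc (suc n) f =
  trans (cong (_+ℤ f (suc (suc n))) (sumTo-suc n f)) (+-assoc (f 0) _ _)

sumTo-tail : ∀ n (f : ℕ → ℤ) → f 0 ≡ + 0 → sumTo (suc n) f ≡ sumTo n (λ i → f (suc i))
sumTo-tail n f f0≡0 =
  trans (sumTo-suc n f) (trans (cong (_+ℤ sumTo n (λ i → f (suc i))) f0≡0) (+-identityˡ _))

sumTo-head : ∀ n (f : ℕ → ℤ) → (∀ i → f (suc i) ≡ + 0) → sumTo n f ≡ f 0
sumTo-head zero    f tail≡0 = refl
sumTo-head (suc n) f tail≡0 =
  trans (sumTo-suc n f) (trans (cong (f 0 +ℤ_) (sumTo-zero n tail≡0)) (+-identityʳ (f 0)))

𝟙 : Bool → ℤ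
𝟙 b = if b then + 1 else + 0

𝟙-∧ : ∀ a b → 𝟙 (a ∧ b) ≡ 𝟙 a *ℤ 𝟙 b
𝟙-∧ true  b = sym (*-identityˡ (𝟙 b))
𝟙-∧ false b = refl

sumTo-𝟙-≡ᵇ : ∀ n a → sumTo n (λ j → 𝟙 (a ≡ᵇ j)) ≡ 𝟙 (a <ᵇ suc n)
sumTo-𝟙-≡ᵇ zero    zero    = refl
sumTo-𝟙-≡ᵇ zero    (suc a) = refl
sumTo-𝟙-≡ᵇ (suc n) zero    =
  trans (sumTo-suc n _) (cong (+ 1 +ℤ_) (sumTo-zero n (λ _ → refl)))
sumTo-𝟙-≡ᵇ (suc n) (suc a) = trans (sumTo-tail n _ refl) (sumTo-𝟙-≡ᵇ n a)

everyᵇ : (n : ℕ) → (Fin n → Bool) → Bool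
everyᵇ n p = and (tabulate p)

everyᵇ-cong : ∀ n {p q : Fin n → Bool} → (∀ i → p i ≡ q i) → everyᵇ n p ≡ everyᵇ n q
everyᵇ-cong n p≡q = cong and (tabulate-cong p≡q)

everyᵇ-true : ∀ n {p : Fin n → Bool} → (∀ i → p i ≡ true) → everyᵇ n p ≡ true
everyᵇ-true zero    p≡true = refl
everyᵇ-true (suc n) p≡true rewrite p≡true zero = everyᵇ-true n (λ i → p≡true (suc i))

allᵇ-allFin : ∀ n (p : Fin n → Bool) → allᵇ p (allFinᴸ n) ≡ everyᵇ n p
allᵇ-allFin n p = cong and (map-tabulate (λ i → i) p)

-- Once isPosition is written with everyᵇ, the split is definitional: the pairs (0, 0) and
-- (i + 1, 0) fail i < j, and the pairs (i + 1, j + 1) are exactly the pairs of v.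
isPosition-∷ : ∀ G {n} x (v : Colouring n) →
  isPosition G (suc n) (x ∷ v)
    ≡ everyᵇ n (λ j → compatible G (suc (toℕ j)) x (lookup v j)) ∧ isPosition G n v
isPosition-∷ G {n} x v =
  trans (pairwise (x ∷ v)) (cong (firstRow ∧_) (sym (pairwise v)))
  where
  firstRow = everyᵇ n (λ j → compatible G (suc (toℕ j)) x (lookup v j))
  pairwise : ∀ {m} (c : Colouring m) → isPosition G m c
    ≡ everyᵇ m (λ i → everyᵇ m (λ j →
        (toℕ i <ᵇ toℕ j) ⇒ᵇ compatible G ∣ toℕ i - toℕ j ∣ (lookup c i) (lookup c j)))
  pairwise {m} c = trans (allᵇ-allFin m _) (everyᵇ-cong m (λ i → allᵇ-allFin m _))

isPosition-nothing∷ : ∀ G {n} (v : Colouring n) →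
  isPosition G (suc n) (nothing ∷ v) ≡ isPosition G n v
isPosition-nothing∷ G {n} v =
  trans (isPosition-∷ G nothing v) (cong (_∧ isPosition G n v) (everyᵇ-true n (λ _ → refl)))

leadingEmpty : ℕ → ∀ {n} → Colouring n → Bool
leadingEmpty zero    v       = true
leadingEmpty (suc g) []      = true
leadingEmpty (suc g) (x ∷ v) = is-nothing x ∧ leadingEmpty g v

compatible-EnCis-just : ∀ k d a y →
  compatible (EnCis k) (suc d) (just a) y ≡ is-nothing y ∨ not (d <ᵇ k)
compatible-EnCis-just k d a    nothing     = refl
compatible-EnCis-just k d blue (just blue) = refl
compatible-EnCis-just k d blue (just red)  = refl
compatible-EnCis-just k d red  (just blue) = refl
compatible-EnCis-just k d red  (just red)  = refl

everyᵇ-leadingEmpty : ∀ k {n} (v : Colouring n) →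
  everyᵇ n (λ j → is-nothing (lookup v j) ∨ not (toℕ j <ᵇ k)) ≡ leadingEmpty k v
everyᵇ-leadingEmpty zero    {n} v         = everyᵇ-true n (λ j → ∨-zeroʳ _)
everyᵇ-leadingEmpty (suc k) []            = refl
everyᵇ-leadingEmpty (suc k) (nothing ∷ v) = everyᵇ-leadingEmpty k v
everyᵇ-leadingEmpty (suc k) (just a ∷ v)  = refl

isPosition-EnCis-just∷ : ∀ k {n} a (v : Colouring n) →
  isPosition (EnCis k) (suc n) (just a ∷ v) ≡ leadingEmpty k v ∧ isPosition (EnCis k) n v
isPosition-EnCis-just∷ k {n} a v =
  trans (isPosition-∷ (EnCis k) (just a) v)
        (cong (_∧ isPosition (EnCis k) n v)
              (trans (everyᵇ-cong n (λ j → compatible-EnCis-just k (toℕ j) a (lookup v j)))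
                     (everyᵇ-leadingEmpty k v)))

sumColourings : (n : ℕ) → (Colouring n → ℤ) → ℤ
sumColourings zero    f = f []
sumColourings (suc n) f =
  sumColourings n (λ v → f (nothing ∷ v) +ℤ f (just blue ∷ v) +ℤ f (just red ∷ v))

sumColourings-cong : ∀ n {f g : Colouring n → ℤ} → (∀ v → f v ≡ g v) →
  sumColourings n f ≡ sumColourings n g
sumColourings-cong zero    f≡g = f≡g []
sumColourings-cong (suc n) f≡g = sumColourings-cong n λ v →
  cong₂ _+ℤ_ (cong₂ _+ℤ_ (f≡g (nothing ∷ v)) (f≡g (just blue ∷ v))) (f≡g (just red ∷ v))

sumColourings-+ : ∀ n (f g : Colouring n → ℤ) →
  sumColourings n (λ v → f v +ℤ g v) ≡ sumColourings n f +ℤ sumColourings n g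
sumColourings-+ zero    f g = refl
sumColourings-+ (suc n) f g =
  trans (sumColourings-cong n λ v →
          interchange (f (nothing ∷ v)) (g (nothing ∷ v)) (f (just blue ∷ v)) (g (just blue ∷ v))
                      (f (just red ∷ v)) (g (just red ∷ v)))
        (sumColourings-+ n _ _)
  where
  interchange : ∀ a b c d e f →
    a +ℤ b +ℤ (c +ℤ d) +ℤ (e +ℤ f) ≡ a +ℤ c +ℤ e +ℤ (b +ℤ d +ℤ f)
  interchange = solve-∀

sumColourings-zero : ∀ n → sumColourings n (λ _ → + 0) ≡ + 0
sumColourings-zero zero    = refl
sumColourings-zero (suc n) = sumColourings-zero n

listSum : {A : Set} → (A → ℤ) → List A → ℤ
listSum f = foldr (λ a s → f a +ℤ s) (+ 0)

length-filterᵇ : {A : Set} (p : A → Bool) (xs : List A) →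
  + length (filterᵇ p xs) ≡ listSum (λ a → 𝟙 (p a)) xs
length-filterᵇ p []ᴸ = refl
length-filterᵇ p (x ∷ᴸ xs) with p x
... | true  = cong (+ 1 +ℤ_) (length-filterᵇ p xs)
... | false = trans (length-filterᵇ p xs) (sym (+-identityˡ _))

listSum-++ : {A : Set} (f : A → ℤ) (xs ys : List A) →
  listSum f (xs ++ ys) ≡ listSum f xs +ℤ listSum f ys
listSum-++ f []ᴸ       ys = sym (+-identityˡ _)
listSum-++ f (x ∷ᴸ xs) ys =
  trans (cong (f x +ℤ_) (listSum-++ f xs ys)) (sym (+-assoc (f x) _ _))

listSum-concatMap : {A B : Set} (f : B → ℤ) (g : A → List B) (xs : List A) →
  listSum f (concatMap g xs) ≡ listSum (λ a → listSum f (g a)) xs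
listSum-concatMap f g []ᴸ       = refl
listSum-concatMap f g (x ∷ᴸ xs) =
  trans (listSum-++ f (g x) _) (cong (listSum f (g x) +ℤ_) (listSum-concatMap f g xs))

listSum-allColourings : ∀ n (f : Colouring n → ℤ) →
  listSum f (allColourings n) ≡ sumColourings n f
listSum-allColourings zero    f = +-identityʳ (f [])
listSum-allColourings (suc n) f =
  trans (listSum-concatMap f _ (allColourings n))
  (trans (listSum-allColourings n _)
         (sumColourings-cong n λ v →
           regroup (f (nothing ∷ v)) (f (just blue ∷ v)) (f (just red ∷ v))))
  where
  regroup : ∀ a b c → a +ℤ (b +ℤ (c +ℤ + 0)) ≡ a +ℤ b +ℤ c
  regroup = solve-∀

sumPositions : (k g n : ℕ) → (Colouring n → ℤ) → ℤ
sumPositions k g n w =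
  sumColourings n (λ v → if leadingEmpty g v ∧ isPosition (EnCis k) n v then w v else + 0)

sumPositions-cong : ∀ k g n {w w′ : Colouring n → ℤ} → (∀ v → w v ≡ w′ v) →
  sumPositions k g n w ≡ sumPositions k g n w′
sumPositions-cong k g n w≡w′ =
  sumColourings-cong n (λ v → cong (if _ then_else + 0) (w≡w′ v))

sumPositions-+ : ∀ k g n (w w′ : Colouring n → ℤ) →
  sumPositions k g n (λ v → w v +ℤ w′ v) ≡ sumPositions k g n w +ℤ sumPositions k g n w′
sumPositions-+ k g n w w′ =
  trans (sumColourings-cong n (λ v → if-+ (leadingEmpty g v ∧ isPosition (EnCis k) n v)))
        (sumColourings-+ n _ _)
  where
  if-+ : ∀ {x y} b →
    (if b then x +ℤ y else + 0) ≡ (if b then x else + 0) +ℤ (if b then y else + 0)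
  if-+ true  = refl
  if-+ false = refl

sumPositions-zero : ∀ k g n → sumPositions k g n (λ _ → + 0) ≡ + 0
sumPositions-zero k g n =
  trans (sumColourings-cong n (λ v → if-zero (leadingEmpty g v ∧ isPosition (EnCis k) n v)))
        (sumColourings-zero n)
  where
  if-zero : ∀ b → (if b then + 0 else + 0) ≡ + 0
  if-zero true  = refl
  if-zero false = refl

sumTo-sumPositions : ∀ m k g n (w : ℕ → Colouring n → ℤ) →
  sumTo m (λ i → sumPositions k g n (w i)) ≡ sumPositions k g n (λ v → sumTo m (λ i → w i v))
sumTo-sumPositions zero    k g n w = refl
sumTo-sumPositions (suc m) k g n w =
  trans (cong (_+ℤ sumPositions k g n (w (suc m))) (sumTo-sumPositions m k g n w))
        (sym (sumPositions-+ k g n _ (w (suc m))))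

sumPositions-[] : ∀ k g (w : Colouring 0 → ℤ) → sumPositions k g 0 w ≡ w []
sumPositions-[] k zero    w = refl
sumPositions-[] k (suc g) w = refl

sumPositions-emptyFirst : ∀ k g n (w : Colouring (suc n) → ℤ) →
  sumPositions k (suc g) (suc n) w ≡ sumPositions k g n (λ v → w (nothing ∷ v))
sumPositions-emptyFirst k g n w = sumColourings-cong n λ v →
  trans (cong (λ b → (if leadingEmpty g v ∧ b then w (nothing ∷ v) else + 0) +ℤ + 0 +ℤ + 0)
              (isPosition-nothing∷ (EnCis k) v))
        (trans (+-identityʳ _) (+-identityʳ _))

sumPositions-firstVertex : ∀ k n (w : Colouring (suc n) → ℤ) →
  sumPositions k 0 (suc n) w ≡ sumPositions k 0 n (λ v → w (nothing ∷ v))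
                             +ℤ sumPositions k k n (λ v → w (just blue ∷ v))
                             +ℤ sumPositions k k n (λ v → w (just red ∷ v))
sumPositions-firstVertex k n w =
  trans (sumColourings-cong n λ v →
          cong₂ _+ℤ_ (cong₂ _+ℤ_ (restrict nothing (isPosition-nothing∷ (EnCis k) v))
                                 (restrict (just blue) (isPosition-EnCis-just∷ k blue v)))
                     (restrict (just red) (isPosition-EnCis-just∷ k red v)))
  (trans (sumColourings-+ n _ _) (cong (_+ℤ redFirst) (sumColourings-+ n _ _)))
  where
  redFirst = sumPositions k k n (λ v → w (just red ∷ v))
  restrict : ∀ x {v} {b b′} → b ≡ b′ →
    (if b then w (x ∷ v) else + 0) ≡ (if b′ then w (x ∷ v) else + 0)
  restrict x = cong (if_then _ else + 0)

hasColourCounts : ℕ → ℕ → ∀ {n} → Colouring n → ℤ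
hasColourCounts j l v = 𝟙 ((countColour blue v ≡ᵇ j) ∧ (countColour red v ≡ᵇ l))

<ᵇ-suc : ∀ a m → (a <ᵇ m) ≡ true → (a <ᵇ suc m) ≡ true
<ᵇ-suc zero    m       _ = refl
<ᵇ-suc (suc a) (suc m) h = <ᵇ-suc a m h

countColour-<ᵇ : ∀ c {n} (v : Colouring n) → (countColour c v <ᵇ suc n) ≡ true
countColour-<ᵇ c []      = refl
countColour-<ᵇ c {suc n} (x ∷ v) with isColour c x
... | true  = countColour-<ᵇ c v
... | false = <ᵇ-suc (countColour c v) (suc n) (countColour-<ᵇ c v)

sum-hasColourCounts : ∀ {n} (v : Colouring n) →
  sumTo n (λ j → sumTo n (λ l → hasColourCounts j l v)) ≡ + 1
sum-hasColourCounts {n} v = begin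
  sumTo n (λ j → sumTo n (λ l → 𝟙 ((b ≡ᵇ j) ∧ (r ≡ᵇ l))))
    ≡⟨ sumTo-cong n (λ j → sumTo-cong n (λ l → 𝟙-∧ (b ≡ᵇ j) (r ≡ᵇ l))) ⟩
  sumTo n (λ j → sumTo n (λ l → 𝟙 (b ≡ᵇ j) *ℤ 𝟙 (r ≡ᵇ l)))
    ≡⟨ sumTo-cong n (λ j → sumTo-*ˡ n (𝟙 (b ≡ᵇ j)) _) ⟩
  sumTo n (λ j → 𝟙 (b ≡ᵇ j) *ℤ sumTo n (λ l → 𝟙 (r ≡ᵇ l)))
    ≡⟨ sumTo-cong n (λ j → cong (𝟙 (b ≡ᵇ j) *ℤ_) (sum-𝟙 red)) ⟩
  sumTo n (λ j → 𝟙 (b ≡ᵇ j) *ℤ + 1)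
    ≡⟨ sumTo-cong n (λ j → *-identityʳ (𝟙 (b ≡ᵇ j))) ⟩
  sumTo n (λ j → 𝟙 (b ≡ᵇ j))
    ≡⟨ sum-𝟙 blue ⟩
  + 1 ∎
  where
  open ≡-Reasoning
  b = countColour blue v
  r = countColour red v
  sum-𝟙 : ∀ c → sumTo n (λ j → 𝟙 (countColour c v ≡ᵇ j)) ≡ + 1
  sum-𝟙 c = trans (sumTo-𝟙-≡ᵇ n (countColour c v)) (cong 𝟙 (countColour-<ᵇ c v))

profileCoeff-sumPositions : ∀ k n j l →
  + profileCoeff (EnCis k) n j l ≡ sumPositions k 0 n (hasColourCounts j l)
profileCoeff-sumPositions k n j l =
  trans (length-filterᵇ _ (allColourings n))
  (trans (listSum-allColourings n _)
         (sumColourings-cong n (λ v → 𝟙-∧-if (isPosition (EnCis k) n v))))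
  where
  𝟙-∧-if : ∀ {b} a → 𝟙 (a ∧ b) ≡ (if a then 𝟙 b else + 0)
  𝟙-∧-if true  = refl
  𝟙-∧-if false = refl

profileAt11-sumPositions : ∀ k n → profileAt11 (EnCis k) n ≡ sumPositions k 0 n (λ _ → + 1)
profileAt11-sumPositions k n = begin
  sumTo n (λ j → sumTo n (λ l → + profileCoeff (EnCis k) n j l))
    ≡⟨ sumTo-cong n (λ j → sumTo-cong n (profileCoeff-sumPositions k n j)) ⟩
  sumTo n (λ j → sumTo n (λ l → sumPositions k 0 n (hasColourCounts j l)))
    ≡⟨ sumTo-cong n (λ j → sumTo-sumPositions n k 0 n (λ l → hasColourCounts j l)) ⟩
  sumTo n (λ j → sumPositions k 0 n (λ v → sumTo n (λ l → hasColourCounts j l v)))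
    ≡⟨ sumTo-sumPositions n k 0 n _ ⟩
  sumPositions k 0 n (λ v → sumTo n (λ j → sumTo n (λ l → hasColourCounts j l v)))
    ≡⟨ sumPositions-cong k 0 n sum-hasColourCounts ⟩
  sumPositions k 0 n (λ _ → + 1) ∎
  where open ≡-Reasoning

module Trivariate where

  infix 4 _≈_
  _≈_ : Series3 → Series3 → Set
  A ≈ B = ∀ n j l → A n j l ≡ B n j l

  ≈-setoid : Setoid 0ℓ 0ℓ
  ≈-setoid = record
    { Carrier       = Series3
    ; _≈_           = _≈_
    ; isEquivalence = record
      { refl  = λ n j l → refl
      ; sym   = λ A≈B n j l → sym (A≈B n j l)
      ; trans = λ A≈B B≈C n j l → trans (A≈B n j l) (B≈C n j l)
      }
    }

  open Setoid ≈-setoid using () renaming (refl to ≈-refl; trans to ≈-trans)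
  open import Relation.Binary.Reasoning.Setoid ≈-setoid

  infixr 9 t·_ x·_ y·_ t^_·_

  t·_ x·_ y·_ : Series3 → Series3
  (t· A) zero    j l = + 0
  (t· A) (suc n) j l = A n j l
  (x· A) n zero    l = + 0
  (x· A) n (suc j) l = A n j l
  (y· A) n j zero    = + 0
  (y· A) n j (suc l) = A n j l

  t^_·_ : ℕ → Series3 → Series3
  t^ zero  · A = A
  t^ suc a · A = t· t^ a · A

  Δ : Series3 → Series3
  Δ A = A ⊖ t· A

  𝟘 : Series3
  𝟘 n j l = + 0

  geometric : ℕ → Series3
  geometric zero    = 𝟘
  geometric (suc g) = one ⊕ t· geometric g

  ⊕-cong : ∀ {A A′ B B′} → A ≈ A′ → B ≈ B′ → A ⊕ B ≈ A′ ⊕ B′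
  ⊕-cong A≈ B≈ n j l = cong₂ _+ℤ_ (A≈ n j l) (B≈ n j l)

  ⊕-congˡ : ∀ A {B B′} → B ≈ B′ → A ⊕ B ≈ A ⊕ B′
  ⊕-congˡ A = ⊕-cong (≈-refl {A})

  ⊖-cong : ∀ {A A′ B B′} → A ≈ A′ → B ≈ B′ → A ⊖ B ≈ A′ ⊖ B′
  ⊖-cong A≈ B≈ n j l = cong₂ _-ℤ_ (A≈ n j l) (B≈ n j l)

  ⊖-congˡ : ∀ A {B B′} → B ≈ B′ → A ⊖ B ≈ A ⊖ B′
  ⊖-congˡ A = ⊖-cong (≈-refl {A})

  ⊖-congʳ : ∀ {A A′} B → A ≈ A′ → A ⊖ B ≈ A′ ⊖ B
  ⊖-congʳ B A≈ = ⊖-cong A≈ (≈-refl {B})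

  t·-cong : ∀ {A B} → A ≈ B → t· A ≈ t· B
  t·-cong A≈B zero    j l = refl
  t·-cong A≈B (suc n) j l = A≈B n j l

  x·-cong : ∀ {A B} → A ≈ B → x· A ≈ x· B
  x·-cong A≈B n zero    l = refl
  x·-cong A≈B n (suc j) l = A≈B n j l

  y·-cong : ∀ {A B} → A ≈ B → y· A ≈ y· B
  y·-cong A≈B n j zero    = refl
  y·-cong A≈B n j (suc l) = A≈B n j l

  t^-cong : ∀ a {A B} → A ≈ B → t^ a · A ≈ t^ a · B
  t^-cong zero    A≈B = A≈B
  t^-cong (suc a) A≈B = t·-cong (t^-cong a A≈B)

  Δ-cong : ∀ {A B} → A ≈ B → Δ A ≈ Δ B
  Δ-cong A≈B = ⊖-cong A≈B (t·-cong A≈B)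

  t·-⊕ : ∀ A B → t· (A ⊕ B) ≈ t· A ⊕ t· B
  t·-⊕ A B zero    j l = refl
  t·-⊕ A B (suc n) j l = refl

  t·-⊖ : ∀ A B → t· (A ⊖ B) ≈ t· A ⊖ t· B
  t·-⊖ A B zero    j l = refl
  t·-⊖ A B (suc n) j l = refl

  x·-⊕ : ∀ A B → x· (A ⊕ B) ≈ x· A ⊕ x· B
  x·-⊕ A B n zero    l = refl
  x·-⊕ A B n (suc j) l = refl

  x·-⊖ : ∀ A B → x· (A ⊖ B) ≈ x· A ⊖ x· B
  x·-⊖ A B n zero    l = refl
  x·-⊖ A B n (suc j) l = refl

  y·-⊕ : ∀ A B → y· (A ⊕ B) ≈ y· A ⊕ y· B
  y·-⊕ A B n j zero    = refl
  y·-⊕ A B n j (suc l) = refl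

  y·-⊖ : ∀ A B → y· (A ⊖ B) ≈ y· A ⊖ y· B
  y·-⊖ A B n j zero    = refl
  y·-⊖ A B n j (suc l) = refl

  x·-t· : ∀ A → x· t· A ≈ t· x· A
  x·-t· A zero    zero    l = refl
  x·-t· A zero    (suc j) l = refl
  x·-t· A (suc n) zero    l = refl
  x·-t· A (suc n) (suc j) l = refl

  y·-t· : ∀ A → y· t· A ≈ t· y· A
  y·-t· A zero    j zero    = refl
  y·-t· A zero    j (suc l) = refl
  y·-t· A (suc n) j zero    = refl
  y·-t· A (suc n) j (suc l) = refl

  Δ-⊕ : ∀ A B → Δ (A ⊕ B) ≈ Δ A ⊕ Δ B
  Δ-⊕ A B n j l =
    trans (cong ((A ⊕ B) n j l -ℤ_) (t·-⊕ A B n j l))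
          (interchange (A n j l) (B n j l) ((t· A) n j l) ((t· B) n j l))
    where
    interchange : ∀ a b c d → a +ℤ b -ℤ (c +ℤ d) ≡ a -ℤ c +ℤ (b -ℤ d)
    interchange = solve-∀

  Δ-t· : ∀ A → Δ (t· A) ≈ t· Δ A
  Δ-t· A zero    j l = refl
  Δ-t· A (suc n) j l = refl

  Δ-x· : ∀ A → Δ (x· A) ≈ x· Δ A
  Δ-x· A zero    zero    l = refl
  Δ-x· A zero    (suc j) l = refl
  Δ-x· A (suc n) zero    l = refl
  Δ-x· A (suc n) (suc j) l = refl

  Δ-y· : ∀ A → Δ (y· A) ≈ y· Δ A
  Δ-y· A zero    j zero    = refl
  Δ-y· A zero    j (suc l) = refl
  Δ-y· A (suc n) j zero    = refl
  Δ-y· A (suc n) j (suc l) = refl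

  Δ-linear : ∀ A B → Δ (A ⊕ t· x· B ⊕ t· y· B) ≈ Δ A ⊕ t· x· Δ B ⊕ t· y· Δ B
  Δ-linear A B = begin
    Δ (A ⊕ t· x· B ⊕ t· y· B)
      ≈⟨ Δ-⊕ (A ⊕ t· x· B) (t· y· B) ⟩
    Δ (A ⊕ t· x· B) ⊕ Δ (t· y· B)
      ≈⟨ ⊕-cong (Δ-⊕ A (t· x· B)) (Δ-t· (y· B)) ⟩
    Δ A ⊕ Δ (t· x· B) ⊕ t· Δ (y· B)
      ≈⟨ ⊕-cong (⊕-congˡ (Δ A) (Δ-t· (x· B))) (t·-cong (Δ-y· B)) ⟩
    Δ A ⊕ t· Δ (x· B) ⊕ t· y· Δ B
      ≈⟨ ⊕-cong (⊕-congˡ (Δ A) (t·-cong (Δ-x· B))) (≈-refl {t· y· Δ B}) ⟩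
    Δ A ⊕ t· x· Δ B ⊕ t· y· Δ B ∎

  Δ-geometric : ∀ g → Δ (geometric g) ≈ one ⊖ t^ g · one
  Δ-geometric zero    zero    j l = sym (+-inverseʳ (one 0 j l))
  Δ-geometric zero    (suc n) j l = sym (+-inverseʳ (one (suc n) j l))
  Δ-geometric (suc g) = begin
    Δ (one ⊕ t· geometric g)         ≈⟨ Δ-⊕ one (t· geometric g) ⟩
    Δ one ⊕ Δ (t· geometric g)       ≈⟨ ⊕-congˡ (Δ one) (Δ-t· (geometric g)) ⟩
    Δ one ⊕ t· Δ (geometric g)       ≈⟨ ⊕-congˡ (Δ one) (t·-cong (Δ-geometric g)) ⟩
    Δ one ⊕ t· (one ⊖ t^ g · one)    ≈⟨ telescope ⟩
    one ⊖ t^ suc g · one             ∎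
    where
    telescope : Δ one ⊕ t· (one ⊖ t^ g · one) ≈ one ⊖ t^ suc g · one
    telescope n j l =
      trans (cong ((Δ one) n j l +ℤ_) (t·-⊖ one (t^ g · one) n j l))
            (cancel (one n j l) ((t· one) n j l) ((t^ suc g · one) n j l))
      where
      cancel : ∀ a b c → a -ℤ b +ℤ (b -ℤ c) ≡ a -ℤ c
      cancel = solve-∀

  eliminate-delayed : ∀ {F G H} g →
    Δ F ≈ one ⊕ t· (x· G ⊕ y· G) → G ≈ g ⊕ H →
    Δ F ⊖ t· x· H ⊖ t· y· H ≈ one ⊕ t· x· g ⊕ t· y· g
  eliminate-delayed {F} {G} {H} g ΔF≈ G≈ = begin
    Δ F ⊖ t· x· H ⊖ t· y· H
      ≈⟨ ⊖-congʳ (t· y· H) (⊖-congʳ (t· x· H) ΔF≈) ⟩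
    one ⊕ t· (x· G ⊕ y· G) ⊖ t· x· H ⊖ t· y· H
      ≈⟨ ⊖-congʳ (t· y· H) (⊖-congʳ (t· x· H) (⊕-congˡ one split)) ⟩
    one ⊕ (t· x· g ⊕ t· x· H ⊕ (t· y· g ⊕ t· y· H)) ⊖ t· x· H ⊖ t· y· H
      ≈⟨ (λ n j l → cancel (one n j l) ((t· x· g) n j l) ((t· x· H) n j l)
                          ((t· y· g) n j l) ((t· y· H) n j l)) ⟩
    one ⊕ t· x· g ⊕ t· y· g ∎
    where
    cancel : ∀ o a b c d → o +ℤ (a +ℤ b +ℤ (c +ℤ d)) -ℤ b -ℤ d ≡ o +ℤ a +ℤ c
    cancel = solve-∀
    split : t· (x· G ⊕ y· G) ≈ t· x· g ⊕ t· x· H ⊕ (t· y· g ⊕ t· y· H)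
    split = begin
      t· (x· G ⊕ y· G)
        ≈⟨ t·-⊕ (x· G) (y· G) ⟩
      t· x· G ⊕ t· y· G
        ≈⟨ ⊕-cong (t·-cong (x·-cong G≈)) (t·-cong (y·-cong G≈)) ⟩
      t· x· (g ⊕ H) ⊕ t· y· (g ⊕ H)
        ≈⟨ ⊕-cong (t·-cong (x·-⊕ g H)) (t·-cong (y·-⊕ g H)) ⟩
      t· (x· g ⊕ x· H) ⊕ t· (y· g ⊕ y· H)
        ≈⟨ ⊕-cong (t·-⊕ (x· g) (x· H)) (t·-⊕ (y· g) (y· H)) ⟩
      t· x· g ⊕ t· x· H ⊕ (t· y· g ⊕ t· y· H) ∎

  ⊛-congˡ : ∀ {A A′} B → A ≈ A′ → A ⊛ B ≈ A′ ⊛ B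
  ⊛-congˡ B A≈ n j l = sumTo-cong n λ a → sumTo-cong j λ b → sumTo-cong l λ c →
    cong (_*ℤ B (n ∸ a) (j ∸ b) (l ∸ c)) (A≈ a b c)

  ⊛-congʳ : ∀ A {B B′} → B ≈ B′ → A ⊛ B ≈ A ⊛ B′
  ⊛-congʳ A B≈ n j l = sumTo-cong n λ a → sumTo-cong j λ b → sumTo-cong l λ c →
    cong (A a b c *ℤ_) (B≈ (n ∸ a) (j ∸ b) (l ∸ c))

  ⊖-⊛ : ∀ A B C → (A ⊖ B) ⊛ C ≈ A ⊛ C ⊖ B ⊛ C
  ⊖-⊛ A B C n j l =
    trans (sumTo-cong n λ a →
            trans (sumTo-cong j λ b →
                    trans (sumTo-cong l λ c → *-distribʳ-minus (A a b c) (B a b c) _)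
                          (sumTo-minus l _ _))
                  (sumTo-minus j _ _))
          (sumTo-minus n _ _)

  one-⊛ : ∀ A → one ⊛ A ≈ A
  one-⊛ A n j l =
    trans (sumTo-head n _ λ a → sumTo-zero j λ b → sumTo-zero l λ c →
             *-zeroˡ (A (n ∸ suc a) (j ∸ b) (l ∸ c)))
    (trans (sumTo-head j _ λ b → sumTo-zero l λ c → *-zeroˡ (A n (j ∸ suc b) (l ∸ c)))
    (trans (sumTo-head l _ λ c → *-zeroˡ (A n j (l ∸ suc c)))
           (*-identityˡ (A n j l))))

  t·-⊛ : ∀ A B → (t· A) ⊛ B ≈ t· (A ⊛ B)
  t·-⊛ A B zero    j l =
    sumTo-zero j λ b → sumTo-zero l λ c → *-zeroˡ (B 0 (j ∸ b) (l ∸ c))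
  t·-⊛ A B (suc n) j l =
    sumTo-tail n _ (sumTo-zero j λ b → sumTo-zero l λ c → *-zeroˡ (B (suc n) (j ∸ b) (l ∸ c)))

  x·-⊛ : ∀ A B → (x· A) ⊛ B ≈ x· (A ⊛ B)
  x·-⊛ A B n zero    l =
    sumTo-zero n λ a → sumTo-zero l λ c → *-zeroˡ (B (n ∸ a) 0 (l ∸ c))
  x·-⊛ A B n (suc j) l = sumTo-cong n λ a →
    sumTo-tail j _ (sumTo-zero l λ c → *-zeroˡ (B (n ∸ a) (suc j) (l ∸ c)))

  y·-⊛ : ∀ A B → (y· A) ⊛ B ≈ y· (A ⊛ B)
  y·-⊛ A B n j zero    =
    sumTo-zero n λ a → sumTo-zero j λ b → *-zeroˡ (B (n ∸ a) (j ∸ b) 0)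
  y·-⊛ A B n j (suc l) = sumTo-cong n λ a → sumTo-cong j λ b →
    sumTo-tail l _ (*-zeroˡ (B (n ∸ a) (j ∸ b) (suc l)))

  t^-⊛ : ∀ a A B → (t^ a · A) ⊛ B ≈ t^ a · (A ⊛ B)
  t^-⊛ zero    A B = ≈-refl
  t^-⊛ (suc a) A B = ≈-trans (t·-⊛ (t^ a · A) B) (t·-cong (t^-⊛ a A B))

  mono-t^ : ∀ a → mono a 0 0 ≈ t^ a · one
  mono-t^ zero    n       j l = refl
  mono-t^ (suc a) zero    j l = refl
  mono-t^ (suc a) (suc n) j l = mono-t^ a n j l

  X≈x·one : X ≈ x· one
  X≈x·one zero    zero    l = refl
  X≈x·one (suc n) zero    l = refl
  X≈x·one n       (suc j) l = refl

  Y≈y·one : Y ≈ y· one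
  Y≈y·one zero    zero    zero    = refl
  Y≈y·one zero    (suc j) zero    = refl
  Y≈y·one (suc n) j       zero    = refl
  Y≈y·one n       j       (suc l) = refl

  mono-⊛ : ∀ a A → mono a 0 0 ⊛ A ≈ t^ a · A
  mono-⊛ a A = begin
    mono a 0 0 ⊛ A      ≈⟨ ⊛-congˡ A (mono-t^ a) ⟩
    (t^ a · one) ⊛ A    ≈⟨ t^-⊛ a one A ⟩
    t^ a · (one ⊛ A)    ≈⟨ t^-cong a (one-⊛ A) ⟩
    t^ a · A            ∎

  X-⊛ : ∀ A → X ⊛ A ≈ x· A
  X-⊛ A = ≈-trans (⊛-congˡ A X≈x·one) (≈-trans (x·-⊛ one A) (x·-cong (one-⊛ A)))

  Y-⊛ : ∀ A → Y ⊛ A ≈ y· A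
  Y-⊛ A = ≈-trans (⊛-congˡ A Y≈y·one) (≈-trans (y·-⊛ one A) (y·-cong (one-⊛ A)))

  X-mono : ∀ a → X ⊛ mono (suc a) 0 0 ≈ t· x· t^ a · one
  X-mono a =
    ≈-trans (X-⊛ (mono (suc a) 0 0)) (≈-trans (x·-cong (mono-t^ (suc a))) (x·-t· (t^ a · one)))

  Y-mono : ∀ a → Y ⊛ mono (suc a) 0 0 ≈ t· y· t^ a · one
  Y-mono a =
    ≈-trans (Y-⊛ (mono (suc a) 0 0)) (≈-trans (y·-cong (mono-t^ (suc a))) (y·-t· (t^ a · one)))

  one⊖T-⊛ : ∀ A → (one ⊖ Tₛ) ⊛ A ≈ Δ A
  one⊖T-⊛ A = ≈-trans (⊖-⊛ one Tₛ A) (⊖-cong (one-⊛ A) (mono-⊛ 1 A))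

  denominator-⊛ : ∀ k A →
    denominator k ⊛ A ≈ Δ (Δ A ⊖ t· x· t^ k · A ⊖ t· y· t^ k · A)
  denominator-⊛ k A = begin
    ((one ⊖ Tₛ) ⊛ Q) ⊛ A    ≈⟨ ⊛-congˡ A (one⊖T-⊛ Q) ⟩
    (Q ⊖ t· Q) ⊛ A           ≈⟨ ⊖-⊛ Q (t· Q) A ⟩
    Q ⊛ A ⊖ (t· Q) ⊛ A       ≈⟨ ⊖-congˡ (Q ⊛ A) (t·-⊛ Q A) ⟩
    Δ (Q ⊛ A)                ≈⟨ Δ-cong Q-⊛ ⟩
    Δ (Δ A ⊖ t· x· t^ k · A ⊖ t· y· t^ k · A) ∎
    where
    M = mono (suc k) 0 0
    Q = one ⊖ Tₛ ⊖ X ⊛ M ⊖ Y ⊛ M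
    XM-⊛ : (X ⊛ M) ⊛ A ≈ t· x· t^ k · A
    XM-⊛ = ≈-trans (⊛-congˡ A (X-⊛ M))
           (≈-trans (x·-⊛ M A) (≈-trans (x·-cong (mono-⊛ (suc k) A)) (x·-t· (t^ k · A))))
    YM-⊛ : (Y ⊛ M) ⊛ A ≈ t· y· t^ k · A
    YM-⊛ = ≈-trans (⊛-congˡ A (Y-⊛ M))
           (≈-trans (y·-⊛ M A) (≈-trans (y·-cong (mono-⊛ (suc k) A)) (y·-t· (t^ k · A))))
    Q-⊛ : Q ⊛ A ≈ Δ A ⊖ t· x· t^ k · A ⊖ t· y· t^ k · A
    Q-⊛ = begin
      Q ⊛ A
        ≈⟨ ⊖-⊛ (one ⊖ Tₛ ⊖ X ⊛ M) (Y ⊛ M) A ⟩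
      (one ⊖ Tₛ ⊖ X ⊛ M) ⊛ A ⊖ (Y ⊛ M) ⊛ A
        ≈⟨ ⊖-cong (⊖-⊛ (one ⊖ Tₛ) (X ⊛ M) A) YM-⊛ ⟩
      (one ⊖ Tₛ) ⊛ A ⊖ (X ⊛ M) ⊛ A ⊖ t· y· t^ k · A
        ≈⟨ ⊖-congʳ (t· y· t^ k · A) (⊖-cong (one⊖T-⊛ A) XM-⊛) ⟩
      Δ A ⊖ t· x· t^ k · A ⊖ t· y· t^ k · A ∎

  numerator≈ : ∀ k →
    numerator k ≈ Δ one ⊕ t· x· (one ⊖ t^ k · one) ⊕ t· y· (one ⊖ t^ k · one)
  numerator≈ k = begin
    one ⊖ Tₛ ⊕ X ⊛ Tₛ ⊕ Y ⊛ Tₛ ⊖ X ⊛ M ⊖ Y ⊛ M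
      ≈⟨ ⊖-cong (⊖-cong (⊕-cong (⊕-cong (⊖-congˡ one (mono-t^ 1)) (X-mono 0)) (Y-mono 0))
                        (X-mono k))
                (Y-mono k) ⟩
    one ⊖ t· one ⊕ t· x· one ⊕ t· y· one ⊖ t· x· T ⊖ t· y· T
      ≈⟨ regroup ⟩
    Δ one ⊕ t· x· (one ⊖ T) ⊕ t· y· (one ⊖ T) ∎
    where
    M = mono (suc k) 0 0
    T = t^ k · one
    regroup : one ⊖ t· one ⊕ t· x· one ⊕ t· y· one ⊖ t· x· T ⊖ t· y· T
            ≈ Δ one ⊕ t· x· (one ⊖ T) ⊕ t· y· (one ⊖ T)
    regroup n j l =
      trans (ring (one n j l) ((t· one) n j l) ((t· x· one) n j l) ((t· y· one) n j l)
                  ((t· x· T) n j l) ((t· y· T) n j l))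
            (sym (cong₂ (λ p q → (Δ one) n j l +ℤ p +ℤ q)
                        (≈-trans (t·-cong (x·-⊖ one T)) (t·-⊖ (x· one) (x· T)) n j l)
                        (≈-trans (t·-cong (y·-⊖ one T)) (t·-⊖ (y· one) (y· T)) n j l)))
      where
      ring : ∀ a b c d e f →
        a -ℤ b +ℤ c +ℤ d -ℤ e -ℤ f ≡ a -ℤ b +ℤ (c -ℤ e) +ℤ (d -ℤ f)
      ring = solve-∀

  leadingEmptyGF : ℕ → ℕ → Series3
  leadingEmptyGF k g n j l = sumPositions k g n (hasColourCounts j l)

  leadingEmptyGF-suc : ∀ k g → leadingEmptyGF k (suc g) ≈ one ⊕ t· leadingEmptyGF k g
  leadingEmptyGF-suc k g zero    j l =
    trans (sumPositions-[] k (suc g) (hasColourCounts j l)) (sym (+-identityʳ (one 0 j l)))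
  leadingEmptyGF-suc k g (suc n) j l =
    trans (sumPositions-emptyFirst k g n (hasColourCounts j l))
          (sym (+-identityˡ (leadingEmptyGF k g n j l)))

  leadingEmptyGF-geometric : ∀ k g → leadingEmptyGF k g ≈ geometric g ⊕ t^ g · leadingEmptyGF k 0
  leadingEmptyGF-geometric k zero    n j l = sym (+-identityˡ (leadingEmptyGF k 0 n j l))
  leadingEmptyGF-geometric k (suc g) = begin
    leadingEmptyGF k (suc g)
      ≈⟨ leadingEmptyGF-suc k g ⟩
    one ⊕ t· leadingEmptyGF k g
      ≈⟨ ⊕-congˡ one (t·-cong (leadingEmptyGF-geometric k g)) ⟩
    one ⊕ t· (geometric g ⊕ t^ g · F)
      ≈⟨ ⊕-congˡ one (t·-⊕ (geometric g) (t^ g · F)) ⟩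
    one ⊕ (t· geometric g ⊕ t^ suc g · F)
      ≈⟨ (λ n j l → sym (+-assoc (one n j l) _ _)) ⟩
    one ⊕ t· geometric g ⊕ t^ suc g · F ∎
    where F = leadingEmptyGF k 0

  sumPositions-blue∷ : ∀ k g n j l →
    sumPositions k g n (λ v → hasColourCounts j l (just blue ∷ v)) ≡ (x· leadingEmptyGF k g) n j l
  sumPositions-blue∷ k g n zero    l = sumPositions-zero k g n
  sumPositions-blue∷ k g n (suc j) l = refl

  sumPositions-red∷ : ∀ k g n j l →
    sumPositions k g n (λ v → hasColourCounts j l (just red ∷ v)) ≡ (y· leadingEmptyGF k g) n j l
  sumPositions-red∷ k g n j zero    =
    trans (sumPositions-cong k g n (λ v → cong 𝟙 (∧-zeroʳ _))) (sumPositions-zero k g n)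
  sumPositions-red∷ k g n j (suc l) = refl

  Δ-leadingEmptyGF : ∀ k →
    Δ (leadingEmptyGF k 0) ≈ one ⊕ t· (x· leadingEmptyGF k k ⊕ y· leadingEmptyGF k k)
  Δ-leadingEmptyGF k zero    j l = cong (_+ℤ + 0) (sumPositions-[] k 0 (hasColourCounts j l))
  Δ-leadingEmptyGF k (suc n) j l =
    trans (cong (_-ℤ F n j l)
                (trans (sumPositions-firstVertex k n (hasColourCounts j l))
                       (cong₂ _+ℤ_ (cong (F n j l +ℤ_) (sumPositions-blue∷ k k n j l))
                                   (sumPositions-red∷ k k n j l))))
          (cancel (F n j l) ((x· G) n j l) ((y· G) n j l))
    where
    F = leadingEmptyGF k 0
    G = leadingEmptyGF k k
    cancel : ∀ a b c → a +ℤ b +ℤ c -ℤ a ≡ + 0 +ℤ (b +ℤ c)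
    cancel = solve-∀

  profile-identity : ∀ k → denominator k ⊛ profileGF (EnCis k) ≈ numerator k
  profile-identity k = begin
    denominator k ⊛ profileGF (EnCis k)
      ≈⟨ ⊛-congʳ (denominator k) (λ n j l → profileCoeff-sumPositions k n j l) ⟩
    denominator k ⊛ F
      ≈⟨ denominator-⊛ k F ⟩
    Δ (Δ F ⊖ t· x· t^ k · F ⊖ t· y· t^ k · F)
      ≈⟨ Δ-cong (eliminate-delayed {F} {leadingEmptyGF k k} {t^ k · F} (geometric k)
                                   (Δ-leadingEmptyGF k) (leadingEmptyGF-geometric k k)) ⟩
    Δ (one ⊕ t· x· geometric k ⊕ t· y· geometric k)
      ≈⟨ Δ-linear one (geometric k) ⟩
    Δ one ⊕ t· x· Δ (geometric k) ⊕ t· y· Δ (geometric k)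
      ≈⟨ ⊕-cong (⊕-congˡ (Δ one) (t·-cong (x·-cong (Δ-geometric k))))
                (t·-cong (y·-cong (Δ-geometric k))) ⟩
    Δ one ⊕ t· x· (one ⊖ t^ k · one) ⊕ t· y· (one ⊖ t^ k · one)
      ≈⟨ numerator≈ k ⟨
    numerator k ∎
    where F = leadingEmptyGF k 0

module Univariate where

  open Setoid (ℕ →-setoid ℤ) using () renaming (refl to ≗-refl; trans to ≗-trans)
  open import Relation.Binary.Reasoning.Setoid (ℕ →-setoid ℤ)

  infixr 9 t·_ t^_·_

  t·_ : Series1 → Series1
  (t· A) zero    = + 0
  (t· A) (suc n) = A n

  t^_·_ : ℕ → Series1 → Series1
  t^ zero  · A = A
  t^ suc a · A = t· t^ a · A

  Δ : Series1 → Series1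
  Δ A = A ⊖₁ t· A

  one₁ : Series1
  one₁ = monoT (+ 1) 0

  𝟘 : Series1
  𝟘 n = + 0

  geometric : ℕ → Series1
  geometric zero    = 𝟘
  geometric (suc g) = one₁ ⊕₁ t· geometric g

  ⊕-cong : ∀ {A A′ B B′} → A ≗ A′ → B ≗ B′ → A ⊕₁ B ≗ A′ ⊕₁ B′
  ⊕-cong A≗ B≗ n = cong₂ _+ℤ_ (A≗ n) (B≗ n)

  ⊕-congˡ : ∀ A {B B′} → B ≗ B′ → A ⊕₁ B ≗ A ⊕₁ B′
  ⊕-congˡ A = ⊕-cong (≗-refl {A})

  ⊖-cong : ∀ {A A′ B B′} → A ≗ A′ → B ≗ B′ → A ⊖₁ B ≗ A′ ⊖₁ B′
  ⊖-cong A≗ B≗ n = cong₂ _-ℤ_ (A≗ n) (B≗ n)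

  ⊖-congˡ : ∀ A {B B′} → B ≗ B′ → A ⊖₁ B ≗ A ⊖₁ B′
  ⊖-congˡ A = ⊖-cong (≗-refl {A})

  t·-cong : ∀ {A B} → A ≗ B → t· A ≗ t· B
  t·-cong A≗B zero    = refl
  t·-cong A≗B (suc n) = A≗B n

  t^-cong : ∀ a {A B} → A ≗ B → t^ a · A ≗ t^ a · B
  t^-cong zero    A≗B = A≗B
  t^-cong (suc a) A≗B = t·-cong (t^-cong a A≗B)

  Δ-cong : ∀ {A B} → A ≗ B → Δ A ≗ Δ B
  Δ-cong A≗B = ⊖-cong A≗B (t·-cong A≗B)

  t·-⊕ : ∀ A B → t· (A ⊕₁ B) ≗ t· A ⊕₁ t· B
  t·-⊕ A B zero    = refl
  t·-⊕ A B (suc n) = refl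

  t·-⊖ : ∀ A B → t· (A ⊖₁ B) ≗ t· A ⊖₁ t· B
  t·-⊖ A B zero    = refl
  t·-⊖ A B (suc n) = refl

  Δ-⊕ : ∀ A B → Δ (A ⊕₁ B) ≗ Δ A ⊕₁ Δ B
  Δ-⊕ A B n =
    trans (cong ((A ⊕₁ B) n -ℤ_) (t·-⊕ A B n)) (interchange (A n) (B n) ((t· A) n) ((t· B) n))
    where
    interchange : ∀ a b c d → a +ℤ b -ℤ (c +ℤ d) ≡ a -ℤ c +ℤ (b -ℤ d)
    interchange = solve-∀

  Δ-t· : ∀ A → Δ (t· A) ≗ t· Δ A
  Δ-t· A zero    = refl
  Δ-t· A (suc n) = refl

  Δ-linear : ∀ A B → Δ (A ⊕₁ (t· B ⊕₁ t· B)) ≗ Δ A ⊕₁ (t· Δ B ⊕₁ t· Δ B)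
  Δ-linear A B = begin
    Δ (A ⊕₁ (t· B ⊕₁ t· B))         ≈⟨ Δ-⊕ A (t· B ⊕₁ t· B) ⟩
    Δ A ⊕₁ Δ (t· B ⊕₁ t· B)         ≈⟨ ⊕-congˡ (Δ A) (Δ-⊕ (t· B) (t· B)) ⟩
    Δ A ⊕₁ (Δ (t· B) ⊕₁ Δ (t· B))   ≈⟨ ⊕-congˡ (Δ A) (⊕-cong (Δ-t· B) (Δ-t· B)) ⟩
    Δ A ⊕₁ (t· Δ B ⊕₁ t· Δ B)       ∎

  Δ-geometric : ∀ g → Δ (geometric g) ≗ one₁ ⊖₁ t^ g · one₁
  Δ-geometric zero    zero    = refl
  Δ-geometric zero    (suc n) = refl
  Δ-geometric (suc g) = begin
    Δ (one₁ ⊕₁ t· geometric g)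
      ≈⟨ Δ-⊕ one₁ (t· geometric g) ⟩
    Δ one₁ ⊕₁ Δ (t· geometric g)
      ≈⟨ ⊕-congˡ (Δ one₁) (Δ-t· (geometric g)) ⟩
    Δ one₁ ⊕₁ t· Δ (geometric g)
      ≈⟨ ⊕-congˡ (Δ one₁) (t·-cong (Δ-geometric g)) ⟩
    Δ one₁ ⊕₁ t· (one₁ ⊖₁ t^ g · one₁)
      ≈⟨ telescope ⟩
    one₁ ⊖₁ t^ suc g · one₁ ∎
    where
    telescope : Δ one₁ ⊕₁ t· (one₁ ⊖₁ t^ g · one₁) ≗ one₁ ⊖₁ t^ suc g · one₁
    telescope n =
      trans (cong ((Δ one₁) n +ℤ_) (t·-⊖ one₁ (t^ g · one₁) n))
            (cancel (one₁ n) ((t· one₁) n) ((t^ suc g · one₁) n))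
      where
      cancel : ∀ a b c → a -ℤ b +ℤ (b -ℤ c) ≡ a -ℤ c
      cancel = solve-∀

  eliminate-delayed : ∀ {F G H} g →
    Δ F ≗ one₁ ⊕₁ t· (G ⊕₁ G) → G ≗ g ⊕₁ H →
    Δ F ⊖₁ (t· H ⊕₁ t· H) ≗ one₁ ⊕₁ (t· g ⊕₁ t· g)
  eliminate-delayed {F} {G} {H} g ΔF≗ G≗ n =
    trans (cong (_-ℤ ((t· H) n +ℤ (t· H) n))
                (trans (ΔF≗ n)
                       (cong (one₁ n +ℤ_) (trans (t·-⊕ G G n) (cong (λ p → p +ℤ p) split)))))
          (cancel (one₁ n) ((t· g) n) ((t· H) n))
    where
    split : (t· G) n ≡ (t· g) n +ℤ (t· H) n
    split = trans (t·-cong G≗ n) (t·-⊕ g H n)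
    cancel : ∀ o a b → o +ℤ (a +ℤ b +ℤ (a +ℤ b)) -ℤ (b +ℤ b) ≡ o +ℤ (a +ℤ a)
    cancel = solve-∀

  ⊛-congˡ : ∀ {A A′} B → A ≗ A′ → A ⊛₁ B ≗ A′ ⊛₁ B
  ⊛-congˡ B A≗ n = sumTo-cong n λ a → cong (_*ℤ B (n ∸ a)) (A≗ a)

  ⊛-congʳ : ∀ A {B B′} → B ≗ B′ → A ⊛₁ B ≗ A ⊛₁ B′
  ⊛-congʳ A B≗ n = sumTo-cong n λ a → cong (A a *ℤ_) (B≗ (n ∸ a))

  ⊕-⊛ : ∀ A B C → (A ⊕₁ B) ⊛₁ C ≗ A ⊛₁ C ⊕₁ B ⊛₁ C
  ⊕-⊛ A B C n =
    trans (sumTo-cong n λ a → *-distribʳ-+ (C (n ∸ a)) (A a) (B a)) (sumTo-+ n _ _)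

  ⊖-⊛ : ∀ A B C → (A ⊖₁ B) ⊛₁ C ≗ A ⊛₁ C ⊖₁ B ⊛₁ C
  ⊖-⊛ A B C n =
    trans (sumTo-cong n λ a → *-distribʳ-minus (A a) (B a) (C (n ∸ a))) (sumTo-minus n _ _)

  one₁-⊛ : ∀ A → one₁ ⊛₁ A ≗ A
  one₁-⊛ A n = trans (sumTo-head n _ λ a → *-zeroˡ (A (n ∸ suc a))) (*-identityˡ (A n))

  t·-⊛ : ∀ A B → (t· A) ⊛₁ B ≗ t· (A ⊛₁ B)
  t·-⊛ A B zero    = *-zeroˡ (B 0)
  t·-⊛ A B (suc n) = sumTo-tail n _ (*-zeroˡ (B (suc n)))

  t^-⊛ : ∀ a A B → (t^ a · A) ⊛₁ B ≗ t^ a · (A ⊛₁ B)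
  t^-⊛ zero    A B = ≗-refl
  t^-⊛ (suc a) A B = ≗-trans (t·-⊛ (t^ a · A) B) (t·-cong (t^-⊛ a A B))

  monoT-t^ : ∀ a → monoT (+ 1) a ≗ t^ a · one₁
  monoT-t^ zero    n       = refl
  monoT-t^ (suc a) zero    = refl
  monoT-t^ (suc a) (suc n) = monoT-t^ a n

  monoT-two : ∀ a → monoT (+ 2) a ≗ monoT (+ 1) a ⊕₁ monoT (+ 1) a
  monoT-two a n with a ≡ᵇ n
  ... | true  = refl
  ... | false = refl

  monoT-⊛ : ∀ a A → monoT (+ 1) a ⊛₁ A ≗ t^ a · A
  monoT-⊛ a A = begin
    monoT (+ 1) a ⊛₁ A     ≈⟨ ⊛-congˡ A (monoT-t^ a) ⟩
    (t^ a · one₁) ⊛₁ A     ≈⟨ t^-⊛ a one₁ A ⟩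
    t^ a · (one₁ ⊛₁ A)     ≈⟨ t^-cong a (one₁-⊛ A) ⟩
    t^ a · A               ∎

  one₁⊖T-⊛ : ∀ A → (one₁ ⊖₁ monoT (+ 1) 1) ⊛₁ A ≗ Δ A
  one₁⊖T-⊛ A = ≗-trans (⊖-⊛ one₁ (monoT (+ 1) 1) A) (⊖-cong (one₁-⊛ A) (monoT-⊛ 1 A))

  denominator-⊛ : ∀ k A →
    denominator₁ k ⊛₁ A ≗ Δ (Δ A ⊖₁ (t· t^ k · A ⊕₁ t· t^ k · A))
  denominator-⊛ k A = begin
    ((one₁ ⊖₁ T) ⊛₁ Q) ⊛₁ A    ≈⟨ ⊛-congˡ A (one₁⊖T-⊛ Q) ⟩
    (Q ⊖₁ t· Q) ⊛₁ A           ≈⟨ ⊖-⊛ Q (t· Q) A ⟩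
    Q ⊛₁ A ⊖₁ (t· Q) ⊛₁ A      ≈⟨ ⊖-congˡ (Q ⊛₁ A) (t·-⊛ Q A) ⟩
    Δ (Q ⊛₁ A)                 ≈⟨ Δ-cong Q-⊛ ⟩
    Δ (Δ A ⊖₁ (t· t^ k · A ⊕₁ t· t^ k · A)) ∎
    where
    T = monoT (+ 1) 1
    M = monoT (+ 1) (suc k)
    Q = one₁ ⊖₁ T ⊖₁ monoT (+ 2) (suc k)
    Q-⊛ : Q ⊛₁ A ≗ Δ A ⊖₁ (t· t^ k · A ⊕₁ t· t^ k · A)
    Q-⊛ = begin
      Q ⊛₁ A
        ≈⟨ ⊖-⊛ (one₁ ⊖₁ T) (monoT (+ 2) (suc k)) A ⟩
      (one₁ ⊖₁ T) ⊛₁ A ⊖₁ monoT (+ 2) (suc k) ⊛₁ A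
        ≈⟨ ⊖-cong (one₁⊖T-⊛ A) (⊛-congˡ A (monoT-two (suc k))) ⟩
      Δ A ⊖₁ (M ⊕₁ M) ⊛₁ A
        ≈⟨ ⊖-congˡ (Δ A) (⊕-⊛ M M A) ⟩
      Δ A ⊖₁ (M ⊛₁ A ⊕₁ M ⊛₁ A)
        ≈⟨ ⊖-congˡ (Δ A) (⊕-cong (monoT-⊛ (suc k) A) (monoT-⊛ (suc k) A)) ⟩
      Δ A ⊖₁ (t· t^ k · A ⊕₁ t· t^ k · A) ∎

  numerator≗ : ∀ k →
    numerator₁ k ≗ Δ one₁ ⊕₁ (t· (one₁ ⊖₁ t^ k · one₁) ⊕₁ t· (one₁ ⊖₁ t^ k · one₁))
  numerator≗ k = begin
    one₁ ⊕₁ monoT (+ 1) 1 ⊖₁ monoT (+ 2) (suc k)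
      ≈⟨ ⊖-cong (⊕-congˡ one₁ (monoT-t^ 1))
                (≗-trans (monoT-two (suc k)) (⊕-cong (monoT-t^ (suc k)) (monoT-t^ (suc k)))) ⟩
    one₁ ⊕₁ t· one₁ ⊖₁ (t· T ⊕₁ t· T)
      ≈⟨ regroup ⟩
    Δ one₁ ⊕₁ (t· (one₁ ⊖₁ T) ⊕₁ t· (one₁ ⊖₁ T)) ∎
    where
    T = t^ k · one₁
    regroup : one₁ ⊕₁ t· one₁ ⊖₁ (t· T ⊕₁ t· T)
            ≗ Δ one₁ ⊕₁ (t· (one₁ ⊖₁ T) ⊕₁ t· (one₁ ⊖₁ T))
    regroup n =
      trans (ring (one₁ n) ((t· one₁) n) ((t· T) n))
            (sym (cong (λ p → (Δ one₁) n +ℤ (p +ℤ p)) (t·-⊖ one₁ T n)))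
      where
      ring : ∀ a b c → a +ℤ b -ℤ (c +ℤ c) ≡ a -ℤ b +ℤ ((b -ℤ c) +ℤ (b -ℤ c))
      ring = solve-∀

  leadingEmptyCount : ℕ → ℕ → Series1
  leadingEmptyCount k g n = sumPositions k g n (λ _ → + 1)

  leadingEmptyCount-suc : ∀ k g → leadingEmptyCount k (suc g) ≗ one₁ ⊕₁ t· leadingEmptyCount k g
  leadingEmptyCount-suc k g zero    = sumPositions-[] k (suc g) (λ _ → + 1)
  leadingEmptyCount-suc k g (suc n) =
    trans (sumPositions-emptyFirst k g n (λ _ → + 1)) (sym (+-identityˡ (leadingEmptyCount k g n)))

  leadingEmptyCount-geometric : ∀ k g →
    leadingEmptyCount k g ≗ geometric g ⊕₁ t^ g · leadingEmptyCount k 0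
  leadingEmptyCount-geometric k zero    n = sym (+-identityˡ (leadingEmptyCount k 0 n))
  leadingEmptyCount-geometric k (suc g) = begin
    leadingEmptyCount k (suc g)
      ≈⟨ leadingEmptyCount-suc k g ⟩
    one₁ ⊕₁ t· leadingEmptyCount k g
      ≈⟨ ⊕-congˡ one₁ (t·-cong (leadingEmptyCount-geometric k g)) ⟩
    one₁ ⊕₁ t· (geometric g ⊕₁ t^ g · F)
      ≈⟨ ⊕-congˡ one₁ (t·-⊕ (geometric g) (t^ g · F)) ⟩
    one₁ ⊕₁ (t· geometric g ⊕₁ t^ suc g · F)
      ≈⟨ (λ n → sym (+-assoc (one₁ n) _ _)) ⟩
    one₁ ⊕₁ t· geometric g ⊕₁ t^ suc g · F ∎
    where F = leadingEmptyCount k 0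

  Δ-leadingEmptyCount : ∀ k →
    Δ (leadingEmptyCount k 0) ≗ one₁ ⊕₁ t· (leadingEmptyCount k k ⊕₁ leadingEmptyCount k k)
  Δ-leadingEmptyCount k zero    = cong (_+ℤ + 0) (sumPositions-[] k 0 (λ _ → + 1))
  Δ-leadingEmptyCount k (suc n) =
    trans (cong (_-ℤ leadingEmptyCount k 0 n) (sumPositions-firstVertex k n (λ _ → + 1)))
          (cancel (leadingEmptyCount k 0 n) (leadingEmptyCount k k n))
    where
    cancel : ∀ a b → a +ℤ b +ℤ b -ℤ a ≡ + 0 +ℤ (b +ℤ b)
    cancel = solve-∀

  total-identity : ∀ k → denominator₁ k ⊛₁ totalGF (EnCis k) ≗ numerator₁ k
  total-identity k = begin
    denominator₁ k ⊛₁ totalGF (EnCis k)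
      ≈⟨ ⊛-congʳ (denominator₁ k) (profileAt11-sumPositions k) ⟩
    denominator₁ k ⊛₁ F
      ≈⟨ denominator-⊛ k F ⟩
    Δ (Δ F ⊖₁ (t· t^ k · F ⊕₁ t· t^ k · F))
      ≈⟨ Δ-cong (eliminate-delayed {F} {leadingEmptyCount k k} {t^ k · F} (geometric k)
                                   (Δ-leadingEmptyCount k) (leadingEmptyCount-geometric k k)) ⟩
    Δ (one₁ ⊕₁ (t· geometric k ⊕₁ t· geometric k))
      ≈⟨ Δ-linear one₁ (geometric k) ⟩
    Δ one₁ ⊕₁ (t· Δ (geometric k) ⊕₁ t· Δ (geometric k))
      ≈⟨ ⊕-congˡ (Δ one₁) (⊕-cong (t·-cong (Δ-geometric k)) (t·-cong (Δ-geometric k))) ⟩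
    Δ one₁ ⊕₁ (t· (one₁ ⊖₁ t^ k · one₁) ⊕₁ t· (one₁ ⊖₁ t^ k · one₁))
      ≈⟨ numerator≗ k ⟨
    numerator₁ k ∎
    where F = leadingEmptyCount k 0

mainTheorem2 : (k : ℕ) → 1 ≤ k →
    ((n j l : ℕ) → (denominator k ⊛ profileGF (EnCis k)) n j l ≡ numerator k n j l)
    × ((n : ℕ) → (denominator₁ k ⊛₁ totalGF (EnCis k)) n ≡ numerator₁ k n)
mainTheorem2 k _ = Trivariate.profile-identity k , Univariate.total-identity k
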